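{- Work in higher-order Tarski–Grothendieck set theory. Let $U$ be a transitive, ZF-closed set and let $X$ be a set with $X\subseteq U$ and $X\notin U$. Then there is a function $f:\iota\to\iota$ that is a bijection taking $\{\alpha\in U\mid \alpha \text{ is an ordinal}\}$ onto $X$.
   Context: The ambient theory is a classical, extensional higher-order set theory with sets as base type $\iota$, union, power set $\wp$, replacement $\{F x\mid x\in X\}$ for $F:\iota\to\iota$, separation, $\in$-induction, a choice operator, and Grothendieck universes. A set $U$ is transitive if $X\subseteq U$ for all $X\in U$. $U$ is ZF-closed if for all $X\in U$: $\bigcup X\in U$, $\wp X\in U$, and for every $F:\iota\to\iota$ with $F x\in U$ for all $x\in X$, $\{F x\mid x\in X\}\in U$. A set $\alpha$ is an ordinal if $\alpha$ is transitive and every element of $\alpha$ is transitive. "$f$ is a bijection taking $A$ onto $B$" means: $f u\in B$ for all $u\in A$; $f u=f v$ implies $u=v$ for $u,v\in A$; and every $w\in B$ equals $f u$ for some $u\in A$. -}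

module Defs where

-- A model of the ambient classical, extensional, higher-order
-- Tarski–Grothendieck set theory (as in Egal/Megalodon), packaged as a record.
-- Sets form the base type ι; higher-order functions ι → ι and predicates
-- ι → Set are Agda functions.

open import Data.Product using (Σ; ∃; _×_; _,_)
open import Data.Sum using (_⊎_)
open import Relation.Nullary using (¬_)
open import Relation.Binary.PropositionalEquality using (_≡_)
open import Function.Bundles using (_⇔_)

Subset : {ι : Set} → (ι → ι → Set) → ι → ι → Set
Subset {ι} _∈_ X Y = (z : ι) → z ∈ X → z ∈ Y

Transitive : {ι : Set} → (ι → ι → Set) → ι → Set
Transitive {ι} _∈_ U = (X : ι) → X ∈ U → Subset _∈_ X U

ZFClosed : {ι : Set} → (ι → ι → Set) → (ι → ι) → (ι → ι) → (ι → (ι → ι) → ι) → ι → Set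
ZFClosed {ι} _∈_ ⋃ ℘ Repl U =
  (X : ι) → X ∈ U →
    (⋃ X ∈ U) × (℘ X ∈ U) ×
    ((F : ι → ι) → ((x : ι) → x ∈ X → F x ∈ U) → Repl X F ∈ U)

Ordinal : {ι : Set} → (ι → ι → Set) → ι → Set
Ordinal {ι} _∈_ α = Transitive _∈_ α × ((β : ι) → β ∈ α → Transitive _∈_ β)

record TGModel : Set₁ where
  field
    ι    : Set
    _∈_  : ι → ι → Set
    lem  : (P : Set) → P ⊎ ¬ P
    set-ext : (X Y : ι) → ((z : ι) → (z ∈ X) ⇔ (z ∈ Y)) → X ≡ Y
    ∈-ind : (P : ι → Set) → ((X : ι) → ((x : ι) → x ∈ X → P x) → P X) → (X : ι) → P X
    ⋃    : ι → ι
    ⋃-spec : (X z : ι) → (z ∈ ⋃ X) ⇔ (∃ λ Y → (z ∈ Y) × (Y ∈ X))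
    ℘    : ι → ι
    ℘-spec : (X Y : ι) → (Y ∈ ℘ X) ⇔ Subset _∈_ Y X
    Repl : ι → (ι → ι) → ι
    Repl-spec : (X : ι) (F : ι → ι) (y : ι) → (y ∈ Repl X F) ⇔ (∃ λ x → (x ∈ X) × (y ≡ F x))
    Sep  : ι → (ι → Set) → ι
    Sep-spec : (X : ι) (P : ι → Set) (z : ι) → (z ∈ Sep X P) ⇔ ((z ∈ X) × P z)
    ε    : (ι → Set) → ι
    ε-spec : (P : ι → Set) (x : ι) → P x → P (ε P)
    UnivOf : ι → ι
    UnivOf-In    : (N : ι) → N ∈ UnivOf N
    UnivOf-Trans : (N : ι) → Transitive _∈_ (UnivOf N)
    UnivOf-ZF    : (N : ι) → ZFClosed _∈_ ⋃ ℘ Repl (UnivOf N)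
    UnivOf-Min   : (N U : ι) → N ∈ U → Transitive _∈_ U → ZFClosed _∈_ ⋃ ℘ Repl U →
                   Subset _∈_ (UnivOf N) U

BijOnto : (M : TGModel) → TGModel.ι M → TGModel.ι M → (TGModel.ι M → TGModel.ι M) → Set
BijOnto M A B f =
  ((u : ι) → u ∈ A → f u ∈ B) ×
  ((u v : ι) → u ∈ A → v ∈ A → f u ≡ f v → u ≡ v) ×
  ((w : ι) → w ∈ B → ∃ λ u → (u ∈ A) × (w ≡ f u))
  where open TGModel M

module Submission where

-- Enumerate X along the ordinals of U by transfinite recursion: the
-- α-th value is an element of X, not yet enumerated, of ∈-minimal rank.
--   * Every initial segment {en β | β ∈ α} lies in U (replacement), so it is
--     not all of X (X ∉ U) and a fresh element exists: en maps into X.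
--   * en is injective because ordinals are linearly ordered by ∈ and each
--     value avoids the earlier ones.
--   * If some w ∈ X were never enumerated, minimality of ranks would force
--     rank (en α) ⊆ rank w for all α, so en would inject the ordinals of U
--     into the set of subsets of the rank-slice {y ∈ U | rank y ∈ rank w},
--     which lies in U.  Then the ordinals of U would form a set in U
--     (Burali-Forti for U), which is impossible since it would contain itself.

open import Defs
open import Data.Product using (Σ; ∃; _×_; _,_; proj₁; proj₂)
open import Data.Sum using (_⊎_; inj₁; inj₂)
open import Data.Empty using (⊥-elim)
open import Relation.Nullary using (¬_)
open import Relation.Binary.PropositionalEquality using (_≡_; refl; sym; trans; cong; subst)
open import Function.Bundles using (Equivalence; mk⇔)

open Equivalence using (to; from)

module SetTheory (M : TGModel) where
  open TGModel M

  Ord : ι → Set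
  Ord = Ordinal _∈_

  ⊆-refl : (A : ι) → Subset _∈_ A A
  ⊆-refl A z h = h

  ⊆-antisym : (A B : ι) → Subset _∈_ A B → Subset _∈_ B A → A ≡ B
  ⊆-antisym A B p q = set-ext A B (λ z → mk⇔ (p z) (q z))

  ∈-irrefl : (x : ι) → ¬ (x ∈ x)
  ∈-irrefl = ∈-ind (λ x → ¬ (x ∈ x)) (λ x ih h → ih x h h)

  ∈-minimal : (P : ι → Set) (x : ι) → P x →
              Σ ι λ m → P m × ((y : ι) → y ∈ m → ¬ P y)
  ∈-minimal P = ∈-ind (λ x → P x → Σ ι λ m → P m × ((y : ι) → y ∈ m → ¬ P y)) step
    where
    step : (x : ι) → ((y : ι) → y ∈ x → P y → Σ ι λ m → P m × ((y : ι) → y ∈ m → ¬ P y)) →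
           P x → Σ ι λ m → P m × ((y : ι) → y ∈ m → ¬ P y)
    step x ih px with lem (Σ ι λ y → (y ∈ x) × P y)
    ... | inj₁ (y , hy , py) = ih y hy py
    ... | inj₂ none = x , px , (λ y hy py → none (y , hy , py))

  ∈-Repl : (x : ι) (f : ι → ι) (z : ι) → z ∈ x → f z ∈ Repl x f
  ∈-Repl x f z hz = from (Repl-spec x f (f z)) (z , hz , refl)

  ∈-⋃ : (A Y z : ι) → z ∈ Y → Y ∈ A → z ∈ ⋃ A
  ∈-⋃ A Y z hzY hYA = from (⋃-spec A z) (Y , hzY , hYA)

  Repl-cong : (x : ι) (f g : ι → ι) → ((z : ι) → z ∈ x → f z ≡ g z) → Repl x f ≡ Repl x g
  Repl-cong x f g h = ⊆-antisym _ _ (image f g h) (image g f (λ z hz → sym (h z hz)))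
    where
    image : (f g : ι → ι) → ((z : ι) → z ∈ x → f z ≡ g z) → Subset _∈_ (Repl x f) (Repl x g)
    image f g h y hy with to (Repl-spec x f y) hy
    ... | (z , hz , e) = from (Repl-spec x g y) (z , hz , trans e (h z hz))

  ord-∈ : (a b : ι) → Ord a → b ∈ a → Ord b
  ord-∈ a b (ta , ea) h = ea b h , (λ c hc → ea c (ta b h c hc))

  Trichotomous : ι → ι → Set
  Trichotomous a b = (a ∈ b) ⊎ ((a ≡ b) ⊎ (b ∈ a))

  ord-trichotomy : (a : ι) → Ord a → (b : ι) → Ord b → Trichotomous a b
  ord-trichotomy = ∈-ind (λ a → Ord a → (b : ι) → Ord b → Trichotomous a b) outer
    where
    outer : (a : ι) → ((a' : ι) → a' ∈ a → Ord a' → (b : ι) → Ord b → Trichotomous a' b) →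
            Ord a → (b : ι) → Ord b → Trichotomous a b
    outer a iha oa = ∈-ind (λ b → Ord b → Trichotomous a b) inner
      where
      inner : (b : ι) → ((b' : ι) → b' ∈ b → Ord b' → Trichotomous a b') → Ord b → Trichotomous a b
      inner b ihb ob with lem (Σ ι λ a' → (a' ∈ a) × ((b ∈ a') ⊎ (b ≡ a')))
      ... | inj₁ (a' , ha' , inj₁ h) = inj₂ (inj₂ (proj₁ oa a' ha' b h))
      ... | inj₁ (a' , ha' , inj₂ e) = inj₂ (inj₂ (subst (_∈ a) (sym e) ha'))
      ... | inj₂ noA with lem (Σ ι λ b' → (b' ∈ b) × ((a ∈ b') ⊎ (a ≡ b')))
      ...   | inj₁ (b' , hb' , inj₁ h) = inj₁ (proj₁ ob b' hb' a h)
      ...   | inj₁ (b' , hb' , inj₂ e) = inj₁ (subst (_∈ b) (sym e) hb')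
      ...   | inj₂ noB = inj₂ (inj₁ (⊆-antisym a b a⊆b b⊆a))
        where
        a⊆b : Subset _∈_ a b
        a⊆b a' ha' with iha a' ha' (ord-∈ a a' oa ha') b ob
        ... | inj₁ h = h
        ... | inj₂ (inj₁ e) = ⊥-elim (noA (a' , ha' , inj₂ (sym e)))
        ... | inj₂ (inj₂ h) = ⊥-elim (noA (a' , ha' , inj₁ h))
        b⊆a : Subset _∈_ b a
        b⊆a b' hb' with ihb b' hb' (ord-∈ b b' ob hb')
        ... | inj₁ h = ⊥-elim (noB (b' , hb' , inj₁ h))
        ... | inj₂ (inj₁ e) = ⊥-elim (noB (b' , hb' , inj₂ e))
        ... | inj₂ (inj₂ h) = h

  ord-∉⇒⊆ : (a b : ι) → Ord a → Ord b → ¬ (b ∈ a) → Subset _∈_ a b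
  ord-∉⇒⊆ a b oa ob b∉a with ord-trichotomy a oa b ob
  ... | inj₁ h = proj₁ ob a h
  ... | inj₂ (inj₁ e) = subst (Subset _∈_ a) e (⊆-refl a)
  ... | inj₂ (inj₂ h) = ⊥-elim (b∉a h)

  -- ∈-recursion: for a step G that only looks at values on elements of x,
  -- there is F with F x ≡ G F x.  F is read off the graph R, which is
  -- functional and total by ∈-induction.
  module ∈-Recursion (G : (ι → ι) → ι → ι)
           (G-local : (f g : ι → ι) (x : ι) → ((z : ι) → z ∈ x → f z ≡ g z) → G f x ≡ G g x) where
    data R : ι → ι → Set where
      mk : (x y : ι) (f : ι → ι) → ((z : ι) → z ∈ x → R z (f z)) → y ≡ G f x → R x y

    R-functional : (x y y' : ι) → R x y → R x y' → y ≡ y'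
    R-functional = ∈-ind (λ x → (y y' : ι) → R x y → R x y' → y ≡ y') step
      where
      step : (x : ι) → ((z : ι) → z ∈ x → (y y' : ι) → R z y → R z y' → y ≡ y') →
             (y y' : ι) → R x y → R x y' → y ≡ y'
      step x ih y y' (mk .x .y f h e) (mk .x .y' f' h' e') =
        trans e (trans (G-local f f' x (λ z hz → ih z hz (f z) (f' z) (h z hz) (h' z hz))) (sym e'))

    pick : (x : ι) → ((z : ι) → z ∈ x → Σ ι (R z)) → (z : ι) → (z ∈ x ⊎ ¬ (z ∈ x)) → ι
    pick x ih z (inj₁ p) = proj₁ (ih z p)
    pick x ih z (inj₂ _) = z

    pick-R : (x : ι) (ih : (z : ι) → z ∈ x → Σ ι (R z)) (z : ι) (d : z ∈ x ⊎ ¬ (z ∈ x)) →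
             z ∈ x → R z (pick x ih z d)
    pick-R x ih z (inj₁ p) _ = proj₂ (ih z p)
    pick-R x ih z (inj₂ np) p = ⊥-elim (np p)

    R-total : (x : ι) → Σ ι (R x)
    R-total = ∈-ind (λ x → Σ ι (R x))
      (λ x ih → G (λ z → pick x ih z (lem (z ∈ x))) x ,
                mk x _ _ (λ z p → pick-R x ih z (lem (z ∈ x)) p) refl)

    F : ι → ι
    F x = proj₁ (R-total x)

    F-eq : (x : ι) → F x ≡ G F x
    F-eq x = R-functional x (F x) (G F x) (proj₂ (R-total x))
               (mk x (G F x) F (λ z _ → proj₂ (R-total z)) refl)

  -- Successor a ∪ {a}, carved out of ℘ a (which needs a transitive).
  succ : ι → ι
  succ a = Sep (℘ a) (λ z → (z ∈ a) ⊎ (z ≡ a))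

  ∈-succ-self : (a : ι) → a ∈ succ a
  ∈-succ-self a = from (Sep-spec (℘ a) _ a) (from (℘-spec a a) (⊆-refl a) , inj₂ refl)

  ∈-succ : (a c : ι) → Ord a → c ∈ a → c ∈ succ a
  ∈-succ a c oa h = from (Sep-spec (℘ a) _ c) (from (℘-spec a c) (proj₁ oa c h) , inj₁ h)

  succ-ord : (a : ι) → Ord a → Ord (succ a)
  succ-ord a oa = transitive , elements
    where
    transitive : Transitive _∈_ (succ a)
    transitive z hz c hc with proj₂ (to (Sep-spec (℘ a) _ z) hz)
    ... | inj₁ h = ∈-succ a c oa (proj₁ oa z h c hc)
    ... | inj₂ e = ∈-succ a c oa (subst (c ∈_) e hc)
    elements : (z : ι) → z ∈ succ a → Transitive _∈_ z
    elements z hz with proj₂ (to (Sep-spec (℘ a) _ z) hz)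
    ... | inj₁ h = proj₂ oa z h
    ... | inj₂ e = subst (Transitive _∈_) (sym e) (proj₁ oa)

  ⋃-ord : (A : ι) → ((Y : ι) → Y ∈ A → Ord Y) → Ord (⋃ A)
  ⋃-ord A h = transitive , elements
    where
    transitive : Transitive _∈_ (⋃ A)
    transitive z hz c hc with to (⋃-spec A z) hz
    ... | (Y , hzY , hYA) = ∈-⋃ A Y c (proj₁ (h Y hYA) z hzY c hc) hYA
    elements : (z : ι) → z ∈ ⋃ A → Transitive _∈_ z
    elements z hz with to (⋃-spec A z) hz
    ... | (Y , hzY , hYA) = proj₂ (h Y hYA) z hzY

  rank-step : (ι → ι) → ι → ι
  rank-step f x = ⋃ (Repl x (λ y → succ (f y)))

  rank-step-local : (f g : ι → ι) (x : ι) → ((z : ι) → z ∈ x → f z ≡ g z) →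
                    rank-step f x ≡ rank-step g x
  rank-step-local f g x h = cong ⋃ (Repl-cong x _ _ (λ z hz → cong succ (h z hz)))

  abstract
    rank : ι → ι
    rank = ∈-Recursion.F rank-step rank-step-local

    rank-eq : (x : ι) → rank x ≡ rank-step rank x
    rank-eq = ∈-Recursion.F-eq rank-step rank-step-local

  rank-mono : (x y : ι) → y ∈ x → rank y ∈ rank x
  rank-mono x y hy = subst (rank y ∈_) (sym (rank-eq x))
    (∈-⋃ _ (succ (rank y)) (rank y) (∈-succ-self (rank y)) (∈-Repl x (λ z → succ (rank z)) y hy))

  rank-ord : (x : ι) → Ord (rank x)
  rank-ord = ∈-ind (λ x → Ord (rank x)) step
    where
    step : (x : ι) → ((y : ι) → y ∈ x → Ord (rank y)) → Ord (rank x)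
    step x ih = subst Ord (sym (rank-eq x)) (⋃-ord _ members)
      where
      members : (Y : ι) → Y ∈ Repl x (λ y → succ (rank y)) → Ord Y
      members Y hY with to (Repl-spec x _ Y) hY
      ... | (y , hy , e) = subst Ord (sym e) (succ-ord (rank y) (ih y hy))

  module Universe (U : ι) (U-trans : Transitive _∈_ U)
                  (U-closed : ZFClosed _∈_ ⋃ ℘ Repl U) where

    ⋃-U : (A : ι) → A ∈ U → ⋃ A ∈ U
    ⋃-U A hA = proj₁ (U-closed A hA)

    ℘-U : (A : ι) → A ∈ U → ℘ A ∈ U
    ℘-U A hA = proj₁ (proj₂ (U-closed A hA))

    Repl-U : (A : ι) (f : ι → ι) → A ∈ U → ((x : ι) → x ∈ A → f x ∈ U) → Repl A f ∈ U
    Repl-U A f hA = proj₂ (proj₂ (U-closed A hA)) f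

    ⊆-U : (A B : ι) → Subset _∈_ A B → B ∈ U → A ∈ U
    ⊆-U A B s hB = U-trans (℘ B) (℘-U B hB) A (from (℘-spec B A) s)

    succ-U : (a : ι) → a ∈ U → succ a ∈ U
    succ-U a ha = ⊆-U (succ a) (℘ a) (λ z hz → proj₁ (to (Sep-spec (℘ a) _ z) hz)) (℘-U a ha)

    rank-U : (x : ι) → x ∈ U → rank x ∈ U
    rank-U = ∈-ind (λ x → x ∈ U → rank x ∈ U) step
      where
      step : (x : ι) → ((y : ι) → y ∈ x → y ∈ U → rank y ∈ U) → x ∈ U → rank x ∈ U
      step x ih hx = subst (_∈ U) (sym (rank-eq x))
        (⋃-U _ (Repl-U x (λ y → succ (rank y)) hx
          (λ y hy → succ-U (rank y) (ih y hy (U-trans x hx y hy)))))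

    slice : ι → ι
    slice ρ = Sep U (λ y → rank y ∈ ρ)

    ⊆-slice : (y ρ : ι) → y ∈ U → Subset _∈_ (rank y) ρ → Subset _∈_ y (slice ρ)
    ⊆-slice y ρ hy bound z hz =
      from (Sep-spec U _ z) (U-trans y hy z hz , bound _ (rank-mono y z hz))

    -- Rank slices of U at ρ ∈ U are again in U: slice ρ ⊆ ⋃ {℘ (slice γ) | γ ∈ ρ}.
    slice-U : (ρ : ι) → ρ ∈ U → slice ρ ∈ U
    slice-U = ∈-ind (λ ρ → ρ ∈ U → slice ρ ∈ U) step
      where
      step : (ρ : ι) → ((γ : ι) → γ ∈ ρ → γ ∈ U → slice γ ∈ U) → ρ ∈ U → slice ρ ∈ U
      step ρ ih hρ = ⊆-U (slice ρ) cover slice⊆cover cover-U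
        where
        cover : ι
        cover = ⋃ (Repl ρ (λ γ → ℘ (slice γ)))
        cover-U : cover ∈ U
        cover-U = ⋃-U _ (Repl-U ρ (λ γ → ℘ (slice γ)) hρ
                    (λ γ hγ → ℘-U (slice γ) (ih γ hγ (U-trans ρ hρ γ hγ))))
        slice⊆cover : Subset _∈_ (slice ρ) cover
        slice⊆cover y hy with to (Sep-spec U _ y) hy
        ... | (yU , r) = ∈-⋃ _ (℘ (slice (rank y))) y
                (from (℘-spec (slice (rank y)) y) (⊆-slice y (rank y) yU (⊆-refl (rank y))))
                (∈-Repl ρ (λ γ → ℘ (slice γ)) (rank y) r)

    -- A subset of U that injects into an element of U is itself in U: it is
    -- covered by the image of the inverse map (defaulting to B off the image).
    small-by-injection : (A B : ι) (f : ι → ι) → Subset _∈_ A U → B ∈ U →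
      ((u : ι) → u ∈ A → f u ∈ B) →
      ((u v : ι) → u ∈ A → v ∈ A → f u ≡ f v → u ≡ v) → A ∈ U
    small-by-injection A B f A⊆U hB f-into f-inj = ⊆-U A (Repl B inv) A⊆image (Repl-U B inv hB inv-U)
      where
      Preimage : ι → Set
      Preimage y = ∃ λ u → (u ∈ A) × (f u ≡ y)
      choose : (y : ι) → Preimage y ⊎ ¬ Preimage y → ι
      choose y (inj₁ (u , _ , _)) = u
      choose y (inj₂ _) = B
      inv : ι → ι
      inv y = choose y (lem (Preimage y))
      inv-U : (y : ι) → y ∈ B → inv y ∈ U
      inv-U y _ with lem (Preimage y)
      ... | inj₁ (u , hu , _) = A⊆U u hu
      ... | inj₂ _ = hB
      inv-left : (u : ι) → u ∈ A → (d : Preimage (f u) ⊎ ¬ Preimage (f u)) → u ≡ choose (f u) d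
      inv-left u hu (inj₁ (u' , hu' , e)) = f-inj u u' hu hu' (sym e)
      inv-left u hu (inj₂ nd) = ⊥-elim (nd (u , hu , refl))
      A⊆image : Subset _∈_ A (Repl B inv)
      A⊆image u hu = from (Repl-spec B inv u) (f u , f-into u hu , inv-left u hu (lem (Preimage (f u))))

    OrdU : ι
    OrdU = Sep U Ord

    OrdU-trans : (α β : ι) → α ∈ OrdU → β ∈ α → β ∈ OrdU
    OrdU-trans α β hα hβ with to (Sep-spec U Ord α) hα
    ... | (αU , oα) = from (Sep-spec U Ord β) (U-trans α αU β hβ , ord-∈ α β oα hβ)

    OrdU-⊆ : Subset _∈_ OrdU U
    OrdU-⊆ α hα = proj₁ (to (Sep-spec U Ord α) hα)

    OrdU-ord : (α : ι) → α ∈ OrdU → Ord α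
    OrdU-ord α hα = proj₂ (to (Sep-spec U Ord α) hα)

    -- Burali-Forti relative to U: OrdU is an ordinal, so OrdU ∈ U would give OrdU ∈ OrdU.
    OrdU-∉ : ¬ (OrdU ∈ U)
    OrdU-∉ hU = ∈-irrefl OrdU (from (Sep-spec U Ord OrdU) (hU , OrdU-is-ord))
      where
      OrdU-is-ord : Ord OrdU
      OrdU-is-ord = (λ α hα β hβ → OrdU-trans α β hα hβ) , (λ α hα → proj₁ (OrdU-ord α hα))

    module Enumeration (X : ι) (X⊆U : Subset _∈_ X U) (X∉U : ¬ (X ∈ U)) where

      Fresh : ι → ι → Set
      Fresh A x = (x ∈ X) × (¬ (x ∈ A)) × ((y : ι) → y ∈ X → ¬ (y ∈ A) → ¬ (rank y ∈ rank x))

      fresh-exists : (A : ι) → Subset _∈_ A X → A ∈ U → Fresh A (ε (Fresh A))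
      fresh-exists A A⊆X hA with lem (Σ ι λ x → (x ∈ X) × ¬ (x ∈ A))
      ... | inj₂ none = ⊥-elim (X∉U (subst (_∈ U) (sym (⊆-antisym X A X⊆A A⊆X)) hA))
        where
        X⊆A : Subset _∈_ X A
        X⊆A x hx with lem (x ∈ A)
        ... | inj₁ h = h
        ... | inj₂ nh = ⊥-elim (none (x , hx , nh))
      ... | inj₁ (x₀ , hx₀ , nx₀)
          with ∈-minimal (λ ρ → Σ ι λ x → ((x ∈ X) × ¬ (x ∈ A)) × (rank x ≡ ρ))
                         (rank x₀) (x₀ , (hx₀ , nx₀) , refl)
      ...   | (ρ , (x , (hx , nx) , e) , ρ-min) =
              ε-spec (Fresh A) x (hx , nx , λ y hy ny r →
                ρ-min (rank y) (subst (rank y ∈_) e r) (y , (hy , ny) , refl))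

      enum-step : (ι → ι) → ι → ι
      enum-step f α = ε (Fresh (Repl α f))

      enum-step-local : (f g : ι → ι) (α : ι) → ((z : ι) → z ∈ α → f z ≡ g z) →
                        enum-step f α ≡ enum-step g α
      enum-step-local f g α h = cong (λ A → ε (Fresh A)) (Repl-cong α f g h)

      abstract
        en : ι → ι
        en = ∈-Recursion.F enum-step enum-step-local

        en-eq : (α : ι) → en α ≡ ε (Fresh (Repl α en))
        en-eq = ∈-Recursion.F-eq enum-step enum-step-local

      en-fresh : (α : ι) → α ∈ OrdU → Fresh (Repl α en) (en α)
      en-fresh = ∈-ind (λ α → α ∈ OrdU → Fresh (Repl α en) (en α)) step
        where
        step : (α : ι) → ((β : ι) → β ∈ α → β ∈ OrdU → Fresh (Repl β en) (en β)) →
               α ∈ OrdU → Fresh (Repl α en) (en α)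
        step α ih hα = subst (Fresh (Repl α en)) (sym (en-eq α)) (fresh-exists (Repl α en) earlier⊆X earlier-U)
          where
          earlier-∈X : (β : ι) → β ∈ α → en β ∈ X
          earlier-∈X β hβ = proj₁ (ih β hβ (OrdU-trans α β hα hβ))
          earlier⊆X : Subset _∈_ (Repl α en) X
          earlier⊆X y hy with to (Repl-spec α en y) hy
          ... | (β , hβ , e) = subst (_∈ X) (sym e) (earlier-∈X β hβ)
          earlier-U : Repl α en ∈ U
          earlier-U = Repl-U α en (OrdU-⊆ α hα) (λ β hβ → X⊆U _ (earlier-∈X β hβ))

      en-into : (u : ι) → u ∈ OrdU → en u ∈ X
      en-into u hu = proj₁ (en-fresh u hu)

      en-inj : (u v : ι) → u ∈ OrdU → v ∈ OrdU → en u ≡ en v → u ≡ v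
      en-inj u v hu hv e with ord-trichotomy u (OrdU-ord u hu) v (OrdU-ord v hv)
      ... | inj₁ h = ⊥-elim (proj₁ (proj₂ (en-fresh v hv)) (subst (_∈ Repl v en) e (∈-Repl v en u h)))
      ... | inj₂ (inj₁ h) = h
      ... | inj₂ (inj₂ h) = ⊥-elim (proj₁ (proj₂ (en-fresh u hu)) (subst (_∈ Repl u en) (sym e) (∈-Repl u en v h)))

      -- A never-enumerated w bounds all ranks of values, so en would map OrdU
      -- injectively into ℘ (slice (rank w)) ∈ U, contradicting OrdU-∉.
      en-onto : (w : ι) → w ∈ X → ∃ λ u → (u ∈ OrdU) × (w ≡ en u)
      en-onto w hw with lem (∃ λ u → (u ∈ OrdU) × (w ≡ en u))
      ... | inj₁ h = h
      ... | inj₂ missed = ⊥-elim (OrdU-∉ (small-by-injection OrdU (℘ (slice (rank w))) en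
                              OrdU-⊆ target-U en-into-target en-inj))
        where
        wU : w ∈ U
        wU = X⊆U w hw
        target-U : ℘ (slice (rank w)) ∈ U
        target-U = ℘-U _ (slice-U (rank w) (rank-U w wU))
        rank-bounded : (α : ι) → α ∈ OrdU → Subset _∈_ (rank (en α)) (rank w)
        rank-bounded α hα = ord-∉⇒⊆ (rank (en α)) (rank w) (rank-ord (en α)) (rank-ord w)
                              (proj₂ (proj₂ (en-fresh α hα)) w hw w-fresh)
          where
          w-fresh : ¬ (w ∈ Repl α en)
          w-fresh hw' with to (Repl-spec α en w) hw'
          ... | (β , hβ , e) = missed (β , OrdU-trans α β hα hβ , e)
        en-into-target : (α : ι) → α ∈ OrdU → en α ∈ ℘ (slice (rank w))
        en-into-target α hα = from (℘-spec _ (en α))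
          (⊆-slice (en α) (rank w) (X⊆U _ (en-into α hα)) (rank-bounded α hα))

lemma1 : (M : TGModel) → (U X : TGModel.ι M) →
    Transitive (TGModel._∈_ M) U →
    ZFClosed (TGModel._∈_ M) (TGModel.⋃ M) (TGModel.℘ M) (TGModel.Repl M) U →
    Subset (TGModel._∈_ M) X U →
    ¬ (TGModel._∈_ M X U) →
    Σ (TGModel.ι M → TGModel.ι M) (λ f →
    BijOnto M (TGModel.Sep M U (Ordinal (TGModel._∈_ M))) X f)
lemma1 M U X U-trans U-closed X⊆U X∉U = en , en-into , en-inj , en-onto
  where
  open SetTheory.Universe.Enumeration M U U-trans U-closed X X⊆U X∉U
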